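{- Two linear $\mathbb{Z}_4$-codes $\mathcal{C},\mathcal{C}'$ of length $n$ are equivalent if and only if the digraphs $\Gamma(\mathcal{C})$ and $\Gamma(\mathcal{C}')$ are isomorphic.
   Context: A linear $\mathbb{Z}_4$-code of length $n$ is a $\mathbb{Z}_4$-submodule of $\mathbb{Z}_4^n$. For $\sigma\in S_n$, $\sigma(x)$ permutes the coordinates of $x$, and $\tau_j(x)$ negates the $j$-th coordinate; these act on codes elementwise. Linear codes $\mathcal{C},\mathcal{C}'$ are equivalent if $\mathcal{C}=\tau_{j_1}\cdots\tau_{j_k}\sigma(\mathcal{C}')$ for some $\sigma\in S_n$ and $j_1,\ldots,j_k\in\{1,\ldots,n\}$. With $\mathcal{C}^\#=\mathcal{C}\setminus\{\mathbf 0\}$, $\mathcal{P}=\{1,\ldots,n\}$ and $\mathbb{Z}_4^\#=\{1,2,3\}$, the digraph $\Gamma(\mathcal{C})$ has vertex set $\mathcal{C}^\#\cup(\mathcal{P}\times\mathbb{Z}_4^\#)$ and arc set $\{(c,(j,c_j)): c=(c_1,\ldots,c_n)\in\mathcal{C}^\#, c_j\ne0, j\in\mathcal{P}\}\cup\{((j,x),(j,2)),((j,2),(j,x)): j\in\mathcal{P}, x\in\{1,3\}\}$. -}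

module Defs where

open import Data.Nat using (ℕ)
open import Data.Fin using (Fin)
open import Data.Fin.Permutation using (Permutation′; _⟨$⟩ʳ_)
open import Data.Vec using (Vec; replicate; zipWith; map; tabulate; lookup; updateAt)
import Data.Vec.Properties as VecP
open import Data.List using (List; []; _∷_)
open import Data.Bool using (Bool; true; false; T)
open import Data.Product using (Σ; _×_; ∃; ∃-syntax; _,_)
open import Data.Sum using (_⊎_; inj₁; inj₂)
open import Data.Empty using (⊥)
open import Relation.Nullary using (yes; no)
open import Relation.Nullary.Decidable using (False)
open import Relation.Binary.PropositionalEquality using (_≡_; refl)
open import Relation.Binary.Definitions using (DecidableEquality)
open import Function.Bundles using (_↔_; Inverse; _⇔_)
open import Level using (0ℓ)

data ℤ₄ : Set where
  0# 1# 2# 3# : ℤ₄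

val : ℤ₄ → ℕ
val 0# = 0
val 1# = 1
val 2# = 2
val 3# = 3

suc₄ : ℤ₄ → ℤ₄
suc₄ 0# = 1#
suc₄ 1# = 2#
suc₄ 2# = 3#
suc₄ 3# = 0#

iter : ℕ → (ℤ₄ → ℤ₄) → ℤ₄ → ℤ₄
iter ℕ.zero f x = x
iter (ℕ.suc k) f x = f (iter k f x)

infixl 6 _+₄_
infixl 7 _*₄_

_+₄_ : ℤ₄ → ℤ₄ → ℤ₄
a +₄ b = iter (val b) suc₄ a

_*₄_ : ℤ₄ → ℤ₄ → ℤ₄
a *₄ b = iter (val b) (_+₄ a) 0#

-₄_ : ℤ₄ → ℤ₄
-₄ 0# = 0#
-₄ 1# = 3#
-₄ 2# = 2#
-₄ 3# = 1#

_≟₄_ : DecidableEquality ℤ₄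
0# ≟₄ 0# = yes refl
0# ≟₄ 1# = no λ ()
0# ≟₄ 2# = no λ ()
0# ≟₄ 3# = no λ ()
1# ≟₄ 0# = no λ ()
1# ≟₄ 1# = yes refl
1# ≟₄ 2# = no λ ()
1# ≟₄ 3# = no λ ()
2# ≟₄ 0# = no λ ()
2# ≟₄ 1# = no λ ()
2# ≟₄ 2# = yes refl
2# ≟₄ 3# = no λ ()
3# ≟₄ 0# = no λ ()
3# ≟₄ 1# = no λ ()
3# ≟₄ 2# = no λ ()
3# ≟₄ 3# = yes refl

ℤ₄# : Set
ℤ₄# = Σ ℤ₄ λ x → False (x ≟₄ 0#)

Word : ℕ → Set
Word n = Vec ℤ₄ n

0w : ∀ {n} → Word n
0w = replicate _ 0#

_≟w_ : ∀ {n} → DecidableEquality (Word n)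
_≟w_ = VecP.≡-dec _≟₄_

record LinearCode (n : ℕ) : Set where
  field
    mem      : Word n → Bool
    mem-0    : T (mem 0w)
    mem-+    : ∀ x y → T (mem x) → T (mem y) → T (mem (zipWith _+₄_ x y))
    mem-*    : ∀ (a : ℤ₄) x → T (mem x) → T (mem (map (a *₄_) x))
open LinearCode public

_∈C_ : ∀ {n} → Word n → LinearCode n → Set
x ∈C C = T (mem C x)

permute : ∀ {n} → Permutation′ n → Word n → Word n
permute σ x = tabulate λ i → lookup x (σ ⟨$⟩ʳ i)

τ : ∀ {n} → Fin n → Word n → Word n
τ j x = updateAt x j -₄_

τs : ∀ {n} → List (Fin n) → Word n → Word n
τs [] x = x
τs (j ∷ js) x = τ j (τs js x)

_≡Image_under_ : ∀ {n} → LinearCode n → LinearCode n → (Word n → Word n) → Set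
C ≡Image C' under f = ∀ y → (y ∈C C) ⇔ (∃[ c ] (c ∈C C' × f c ≡ y))

Equivalent : ∀ {n} → LinearCode n → LinearCode n → Set
Equivalent {n} C C' =
  ∃[ σ ] ∃[ js ] (C ≡Image C' under (λ x → τs {n} js (permute σ x)))

record Digraph : Set₁ where
  field
    Vertex : Set
    Arc    : Vertex → Vertex → Set
open Digraph public

_≅_ : Digraph → Digraph → Set
G ≅ H = Σ (Vertex G ↔ Vertex H) λ f →
  ∀ u v → Arc G u v ⇔ Arc H (Inverse.to f u) (Inverse.to f v)

NonzeroCodeword : ∀ {n} → LinearCode n → Set
NonzeroCodeword {n} C = Σ (Word n) λ c → c ∈C C × False (c ≟w 0w)

ΓVertex : ∀ {n} → LinearCode n → Set
ΓVertex {n} C = NonzeroCodeword C ⊎ (Fin n × ℤ₄#)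

odd : ℤ₄ → Set
odd x = (x ≡ 1#) ⊎ (x ≡ 3#)

ΓArc : ∀ {n} (C : LinearCode n) → ΓVertex C → ΓVertex C → Set
ΓArc C (inj₁ (c , _)) (inj₂ (j , (x , _))) = lookup c j ≡ x
ΓArc C (inj₂ (j , (x , _))) (inj₂ (k , (y , _))) =
  j ≡ k × ((odd x × y ≡ 2#) ⊎ (x ≡ 2# × odd y))
ΓArc C (inj₁ _) (inj₁ _) = ⊥
ΓArc C (inj₂ _) (inj₁ _) = ⊥

Γ : ∀ {n} → LinearCode n → Digraph
Γ C = record { Vertex = ΓVertex C ; Arc = ΓArc C }

-- The vertices (j, x) of Γ(C) form n disjoint paths (j,1) ↔ (j,2) ↔ (j,3), and they are
-- exactly the vertices with an in-arc; codewords only send arcs (c ↦ (j, c_j)) into them.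
-- An isomorphism Γ(C) ≅ Γ(C') therefore maps paths to paths, i.e. it acts on the vertices
-- (j, x) as a signed permutation (j, x) ↦ (π j, ±x): the middle vertex (j,2) has two
-- out-neighbours and so cannot go to an end vertex, and the two ends go to the two ends in
-- one of the two possible orders. Since a codeword is determined by its out-neighbours, the
-- isomorphism maps each codeword c to the image of c under that signed permutation. The
-- converse is the observation that a signed permutation of coordinates induces such an
-- isomorphism, and that τ_{j₁}⋯τ_{jₖ}σ ranges over all signed permutations.
module Submission where

open import Defs
open import Data.Nat using (ℕ; zero; suc)
open import Data.Fin using (Fin; zero; suc)
open import Data.Fin.Properties using (_≟_)
open import Data.Fin.Permutation using (Permutation′; _⟨$⟩ʳ_; _⟨$⟩ˡ_; permutation; inverseˡ; inverseʳ; flip)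
open import Data.Vec using (lookup; tabulate)
open import Data.Vec.Properties using (lookup∘updateAt; lookup∘updateAt′; lookup∘tabulate; tabulate∘lookup; tabulate-cong; lookup-replicate)
open import Data.List using (List; []; _∷_; map)
open import Data.Bool using (Bool; true; false; not)
open import Data.Bool.Properties using (T-irrelevant)
open import Data.Unit using (tt)
open import Data.Product using (_×_; _,_; proj₁; proj₂; ∃-syntax)
open import Data.Sum using (_⊎_; inj₁; inj₂)
open import Data.Sum.Properties using (inj₂-injective)
open import Data.Empty using (⊥-elim)
open import Relation.Nullary using (¬_; yes; no)
open import Relation.Nullary.Decidable using (toWitnessFalse; fromWitnessFalse)
open import Relation.Binary.PropositionalEquality
open import Function using (_∘_)
open import Function.Bundles using (Inverse; Equivalence; _⇔_; mk⇔; mk↔ₛ′)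

sign : Bool → ℤ₄ → ℤ₄
sign false x = x
sign true  x = -₄ x

sign-involutive : ∀ b x → sign b (sign b x) ≡ x
sign-involutive false x  = refl
sign-involutive true  0# = refl
sign-involutive true  1# = refl
sign-involutive true  2# = refl
sign-involutive true  3# = refl

-₄∘sign : ∀ b x → -₄ (sign b x) ≡ sign (not b) x
-₄∘sign false x  = refl
-₄∘sign true  x  = sign-involutive true x

sign-0 : ∀ b → sign b 0# ≡ 0#
sign-0 false = refl
sign-0 true  = refl

sign-2 : ∀ b → sign b 2# ≡ 2#
sign-2 false = refl
sign-2 true  = refl

sign-injective : ∀ b {x y} → sign b x ≡ sign b y → x ≡ y
sign-injective b {x} {y} eq = begin
  x                  ≡⟨ sign-involutive b x ⟨
  sign b (sign b x)  ≡⟨ cong (sign b) eq ⟩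
  sign b (sign b y)  ≡⟨ sign-involutive b y ⟩
  y                  ∎
  where open ≡-Reasoning

sign-odd : ∀ b {x} → odd x → odd (sign b x)
sign-odd false o            = o
sign-odd true  (inj₁ refl) = inj₂ refl
sign-odd true  (inj₂ refl) = inj₁ refl

¬odd-2 : ¬ odd 2#
¬odd-2 (inj₁ ())
¬odd-2 (inj₂ ())

odd-pair-sign : ∀ {a c} → odd a → odd c → a ≢ c → ∃[ b ] a ≡ sign b 1# × c ≡ sign b 3#
odd-pair-sign (inj₁ refl) (inj₁ refl) a≢c = ⊥-elim (a≢c refl)
odd-pair-sign (inj₁ refl) (inj₂ refl) _   = false , refl , refl
odd-pair-sign (inj₂ refl) (inj₁ refl) _   = true , refl , refl
odd-pair-sign (inj₂ refl) (inj₂ refl) a≢c = ⊥-elim (a≢c refl)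

Linked : ℤ₄ → ℤ₄ → Set
Linked x y = (odd x × y ≡ 2#) ⊎ (x ≡ 2# × odd y)

sign-linked : ∀ b {x y} → Linked x y → Linked (sign b x) (sign b y)
sign-linked b (inj₁ (o , refl)) = inj₁ (sign-odd b o , sign-2 b)
sign-linked b (inj₂ (refl , o)) = inj₂ (sign-2 b , sign-odd b o)

sign-linked⁻¹ : ∀ b {x y} → Linked (sign b x) (sign b y) → Linked x y
sign-linked⁻¹ b {x} {y} = subst₂ Linked (sign-involutive b x) (sign-involutive b y) ∘ sign-linked b

ℤ₄#-≡ : {x y : ℤ₄#} → proj₁ x ≡ proj₁ y → x ≡ y
ℤ₄#-≡ {x , p} {.x , q} refl = cong (x ,_) (T-irrelevant p q)

one# two# three# : ℤ₄#
one#   = 1# , tt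
two#   = 2# , tt
three# = 3# , tt

sign# : Bool → ℤ₄# → ℤ₄#
sign# b x = sign b (proj₁ x) , fromWitnessFalse λ eq →
  toWitnessFalse (proj₂ x) (sign-injective b (trans eq (sym (sign-0 b))))

ℤ₄#-¬odd⇒2 : (x : ℤ₄#) → ¬ odd (proj₁ x) → proj₁ x ≡ 2#
ℤ₄#-¬odd⇒2 (0# , ())
ℤ₄#-¬odd⇒2 (1# , _) ¬o = ⊥-elim (¬o (inj₁ refl))
ℤ₄#-¬odd⇒2 (2# , _) _  = refl
ℤ₄#-¬odd⇒2 (3# , _) ¬o = ⊥-elim (¬o (inj₂ refl))

-- The case a = 0 uses x = ±c.
sign-determined : ∀ b {a c} → (∀ (x : ℤ₄#) → (a ≡ proj₁ x) ⇔ (c ≡ sign b (proj₁ x))) → c ≡ sign b a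
sign-determined b {1#} spec = Equivalence.to (spec one#) refl
sign-determined b {2#} spec = Equivalence.to (spec two#) refl
sign-determined b {3#} spec = Equivalence.to (spec three#) refl
sign-determined b {0#} {c} spec with c ≟₄ 0#
... | yes c≡0 = trans c≡0 (sym (sign-0 b))
... | no  c≢0 = ⊥-elim (toWitnessFalse (proj₂ x) (sym (Equivalence.from (spec x) (sym (sign-involutive b c)))))
  where x = sign# b (c , fromWitnessFalse c≢0)

≗-lookup⇒≡ : ∀ {n} {x y : Word n} → (∀ i → lookup x i ≡ lookup y i) → x ≡ y
≗-lookup⇒≡ {x = x} {y} eq = trans (sym (tabulate∘lookup x)) (trans (tabulate-cong eq) (tabulate∘lookup y))

negated : ∀ {n} → List (Fin n) → Fin n → Bool
negated []       i = false
negated (j ∷ js) i with j ≟ i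
... | yes _ = not (negated js i)
... | no  _ = negated js i

lookup-τs : ∀ {n} js (x : Word n) i → lookup (τs js x) i ≡ sign (negated js i) (lookup x i)
lookup-τs []       x i = refl
lookup-τs (j ∷ js) x i with j ≟ i
... | yes refl = begin
  lookup (τ j (τs js x)) j                ≡⟨ lookup∘updateAt j (τs js x) ⟩
  -₄ (lookup (τs js x) j)                 ≡⟨ cong -₄_ (lookup-τs js x j) ⟩
  -₄ (sign (negated js j) (lookup x j))   ≡⟨ -₄∘sign (negated js j) (lookup x j) ⟩
  sign (not (negated js j)) (lookup x j)  ∎
  where open ≡-Reasoning
... | no j≢i = trans (lookup∘updateAt′ i j (j≢i ∘ sym) (τs js x)) (lookup-τs js x i)

lookup-τs∘permute : ∀ {n} js σ (x : Word n) i →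
  lookup (τs js (permute σ x)) i ≡ sign (negated js i) (lookup x (σ ⟨$⟩ʳ i))
lookup-τs∘permute js σ x i =
  trans (lookup-τs js (permute σ x) i) (cong (sign (negated js i)) (lookup∘tabulate (lookup x ∘ (σ ⟨$⟩ʳ_)) i))

negations : ∀ {n} → (Fin n → Bool) → List (Fin n)
negations {zero}  s = []
negations {suc n} s with s zero
... | true  = zero ∷ map suc (negations (s ∘ suc))
... | false = map suc (negations (s ∘ suc))

negated-map-suc-zero : ∀ {n} (js : List (Fin n)) → negated (map suc js) zero ≡ false
negated-map-suc-zero []       = refl
negated-map-suc-zero (j ∷ js) = negated-map-suc-zero js

negated-map-suc : ∀ {n} (js : List (Fin n)) i → negated (map suc js) (suc i) ≡ negated js i
negated-map-suc []       i = refl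
negated-map-suc (j ∷ js) i with j ≟ i
... | yes _ = cong not (negated-map-suc js i)
... | no  _ = negated-map-suc js i

negated-negations : ∀ {n} (s : Fin n → Bool) i → negated (negations s) i ≡ s i
negated-negations {suc n} s i with s zero in s₀
negated-negations s zero    | true  = trans (cong not (negated-map-suc-zero (negations (s ∘ suc)))) (sym s₀)
negated-negations s zero    | false = trans (negated-map-suc-zero (negations (s ∘ suc))) (sym s₀)
negated-negations s (suc i) | true  = trans (negated-map-suc (negations (s ∘ suc)) i) (negated-negations (s ∘ suc) i)
negated-negations s (suc i) | false = trans (negated-map-suc (negations (s ∘ suc)) i) (negated-negations (s ∘ suc) i)

record SignedPermutation (n : ℕ) : Set where
  field
    perm  : Permutation′ n
    signs : Fin n → Bool

module _ {n} (g : SignedPermutation n) where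
  open SignedPermutation g

  act : Word n → Word n
  act x = tabulate λ i → sign (signs (perm ⟨$⟩ˡ i)) (lookup x (perm ⟨$⟩ˡ i))

  unact : Word n → Word n
  unact y = tabulate λ j → sign (signs j) (lookup y (perm ⟨$⟩ʳ j))

  lookup-act : ∀ x j → lookup (act x) (perm ⟨$⟩ʳ j) ≡ sign (signs j) (lookup x j)
  lookup-act x j = trans (lookup∘tabulate _ (perm ⟨$⟩ʳ j)) (cong (λ i → sign (signs i) (lookup x i)) (inverseˡ perm))

  act-unique : ∀ x y → (∀ j → lookup y (perm ⟨$⟩ʳ j) ≡ sign (signs j) (lookup x j)) → act x ≡ y
  act-unique x y spec = ≗-lookup⇒≡ λ i → begin
    lookup (act x) i                          ≡⟨ cong (lookup (act x)) (inverseʳ perm) ⟨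
    lookup (act x) (perm ⟨$⟩ʳ (perm ⟨$⟩ˡ i))  ≡⟨ lookup-act x (perm ⟨$⟩ˡ i) ⟩
    sign (signs (perm ⟨$⟩ˡ i)) (lookup x (perm ⟨$⟩ˡ i))  ≡⟨ spec (perm ⟨$⟩ˡ i) ⟨
    lookup y (perm ⟨$⟩ʳ (perm ⟨$⟩ˡ i))        ≡⟨ cong (lookup y) (inverseʳ perm) ⟩
    lookup y i                                ∎
    where open ≡-Reasoning

  act-unact : ∀ y → act (unact y) ≡ y
  act-unact y = act-unique (unact y) y λ j → begin
    lookup y (perm ⟨$⟩ʳ j)                                    ≡⟨ sign-involutive (signs j) _ ⟨
    sign (signs j) (sign (signs j) (lookup y (perm ⟨$⟩ʳ j)))  ≡⟨ cong (sign (signs j)) (lookup∘tabulate _ j) ⟨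
    sign (signs j) (lookup (unact y) j)                       ∎
    where open ≡-Reasoning

  unact-act : ∀ x → unact (act x) ≡ x
  unact-act x = ≗-lookup⇒≡ λ j → begin
    lookup (unact (act x)) j                       ≡⟨ lookup∘tabulate _ j ⟩
    sign (signs j) (lookup (act x) (perm ⟨$⟩ʳ j))  ≡⟨ cong (sign (signs j)) (lookup-act x j) ⟩
    sign (signs j) (sign (signs j) (lookup x j))   ≡⟨ sign-involutive (signs j) _ ⟩
    lookup x j                                     ∎
    where open ≡-Reasoning

  act-injective : ∀ {x y} → act x ≡ act y → x ≡ y
  act-injective {x} {y} eq = trans (sym (unact-act x)) (trans (cong unact eq) (unact-act y))

  act-0w : act 0w ≡ 0w
  act-0w = act-unique 0w 0w λ j → trans (lookup-replicate (perm ⟨$⟩ʳ j) 0#)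
    (sym (trans (cong (sign (signs j)) (lookup-replicate j 0#)) (sign-0 (signs j))))

≡Image-cong : ∀ {n} {C C' : LinearCode n} {f g : Word n → Word n} →
  f ≗ g → C ≡Image C' under f → C ≡Image C' under g
≡Image-cong f≗g image y = mk⇔
  (λ y∈C → let c , c∈C' , fc≡y = Equivalence.to (image y) y∈C in c , c∈C' , trans (sym (f≗g c)) fc≡y)
  (λ { (c , c∈C' , gc≡y) → Equivalence.from (image y) (c , c∈C' , trans (f≗g c) gc≡y) })

≡Image-from-nonzero : ∀ {n} {C C' : LinearCode n} {f : Word n → Word n} → f 0w ≡ 0w →
  (∀ (y : NonzeroCodeword C) → ∃[ c ] (c ∈C C' × f c ≡ proj₁ y)) →
  (∀ (c : NonzeroCodeword C') → f (proj₁ c) ∈C C) →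
  C ≡Image C' under f
≡Image-from-nonzero {C = C} {C'} {f} f0≡0 preimage image-∈ y = mk⇔ (preimage′ y) (image-∈′ y)
  where
    preimage′ : ∀ y → y ∈C C → ∃[ c ] (c ∈C C' × f c ≡ y)
    preimage′ y y∈C with y ≟w 0w
    ... | yes refl = 0w , mem-0 C' , f0≡0
    ... | no  y≢0 = preimage (y , y∈C , fromWitnessFalse y≢0)

    image-∈′ : ∀ y → ∃[ c ] (c ∈C C' × f c ≡ y) → y ∈C C
    image-∈′ _ (c , c∈C' , refl) with c ≟w 0w
    ... | yes refl = subst (_∈C C) (sym f0≡0) (mem-0 C)
    ... | no  c≢0 = image-∈ (c , c∈C' , fromWitnessFalse c≢0)

equivalent⇒signed : ∀ {n} {C C' : LinearCode n} → Equivalent C C' → ∃[ g ] C ≡Image C' under act g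
equivalent⇒signed {n} {C} {C'} (σ , js , image) = g , ≡Image-cong {C = C} {C'} τs∘permute≡act image
  where
    g : SignedPermutation n
    g = record { perm = flip σ ; signs = negated js ∘ (σ ⟨$⟩ˡ_) }

    τs∘permute≡act : τs js ∘ permute σ ≗ act g
    τs∘permute≡act x = sym (act-unique g x (τs js (permute σ x)) λ j →
      trans (lookup-τs∘permute js σ x (σ ⟨$⟩ˡ j)) (cong (sign (negated js (σ ⟨$⟩ˡ j)) ∘ lookup x) (inverseʳ σ)))

signed⇒equivalent : ∀ {n} {C C' : LinearCode n} g → C ≡Image C' under act g → Equivalent C C'
signed⇒equivalent {C = C} {C'} g image = flip perm , negations s , ≡Image-cong {C = C} {C'} act≡τs∘permute image
  where
    open SignedPermutation g
    s = signs ∘ (perm ⟨$⟩ˡ_)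

    act≡τs∘permute : act g ≗ τs (negations s) ∘ permute (flip perm)
    act≡τs∘permute x = ≗-lookup⇒≡ λ i → begin
      lookup (act g x) i                                       ≡⟨ lookup∘tabulate _ i ⟩
      sign (s i) (lookup x (perm ⟨$⟩ˡ i))                      ≡⟨ cong (λ b → sign b (lookup x (perm ⟨$⟩ˡ i))) (negated-negations s i) ⟨
      sign (negated (negations s) i) (lookup x (perm ⟨$⟩ˡ i))  ≡⟨ lookup-τs∘permute (negations s) (flip perm) x i ⟨
      lookup (τs (negations s) (permute (flip perm) x)) i      ∎
      where open ≡-Reasoning

NonzeroCodeword-≡ : ∀ {n} {C : LinearCode n} {c d : NonzeroCodeword C} → proj₁ c ≡ proj₁ d → c ≡ d
NonzeroCodeword-≡ {c = c , c∈C , c≢0} {.c , c∈C′ , c≢0′} refl =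
  cong₂ (λ p q → c , p , q) (T-irrelevant c∈C c∈C′) (T-irrelevant c≢0 c≢0′)

Position : ℕ → Set
Position n = Fin n × ℤ₄#

Position-≡ : ∀ {n} {j k : Fin n} {x y : ℤ₄#} → j ≡ k → proj₁ x ≡ proj₁ y → (j , x) ≡ (k , y)
Position-≡ j≡k x≡y = cong₂ _,_ j≡k (ℤ₄#-≡ x≡y)

-- Definitionally equal to ΓArc C (inj₂ p) (inj₂ q), for every C.
PositionArc : ∀ {n} → Position n → Position n → Set
PositionArc (j , x) (k , y) = j ≡ k × Linked (proj₁ x) (proj₁ y)

module Γ-of-image {n} {C C' : LinearCode n} {g : SignedPermutation n} (image : C ≡Image C' under act g) where
  open SignedPermutation g

  act-∈ : ∀ {c} → c ∈C C' → act g c ∈C C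
  act-∈ c∈C' = Equivalence.from (image _) (_ , c∈C' , refl)

  unact-∈ : ∀ {y} → y ∈C C → unact g y ∈C C'
  unact-∈ {y} y∈C with Equivalence.to (image y) y∈C
  ... | c , c∈C' , refl = subst (_∈C C') (sym (unact-act g c)) c∈C'

  act-nonzero : NonzeroCodeword C' → NonzeroCodeword C
  act-nonzero (c , c∈C' , c≢0) = act g c , act-∈ c∈C' , fromWitnessFalse λ eq →
    toWitnessFalse c≢0 (act-injective g (trans eq (sym (act-0w g))))

  unact-nonzero : NonzeroCodeword C → NonzeroCodeword C'
  unact-nonzero (y , y∈C , y≢0) = unact g y , unact-∈ y∈C , fromWitnessFalse λ eq →
    toWitnessFalse y≢0 (trans (sym (act-unact g y)) (trans (cong (act g) eq) (act-0w g)))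

  vertex : ΓVertex C' → ΓVertex C
  vertex (inj₁ c)       = inj₁ (act-nonzero c)
  vertex (inj₂ (j , x)) = inj₂ (perm ⟨$⟩ʳ j , sign# (signs j) x)

  vertex⁻¹ : ΓVertex C → ΓVertex C'
  vertex⁻¹ (inj₁ y)       = inj₁ (unact-nonzero y)
  vertex⁻¹ (inj₂ (k , y)) = inj₂ (perm ⟨$⟩ˡ k , sign# (signs (perm ⟨$⟩ˡ k)) y)

  vertex-vertex⁻¹ : ∀ v → vertex (vertex⁻¹ v) ≡ v
  vertex-vertex⁻¹ (inj₁ (y , _))  = cong inj₁ (NonzeroCodeword-≡ {C = C} (act-unact g y))
  vertex-vertex⁻¹ (inj₂ (k , y)) =
    cong inj₂ (Position-≡ (inverseʳ perm) (sign-involutive (signs (perm ⟨$⟩ˡ k)) (proj₁ y)))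

  vertex⁻¹-vertex : ∀ v → vertex⁻¹ (vertex v) ≡ v
  vertex⁻¹-vertex (inj₁ (c , _))  = cong inj₁ (NonzeroCodeword-≡ {C = C'} (unact-act g c))
  vertex⁻¹-vertex (inj₂ (j , x)) = cong inj₂ (Position-≡ (inverseˡ perm) (begin
    sign (signs (perm ⟨$⟩ˡ (perm ⟨$⟩ʳ j))) (sign (signs j) (proj₁ x))
      ≡⟨ cong (λ i → sign (signs i) (sign (signs j) (proj₁ x))) (inverseˡ perm) ⟩
    sign (signs j) (sign (signs j) (proj₁ x))
      ≡⟨ sign-involutive (signs j) (proj₁ x) ⟩
    proj₁ x ∎))
    where open ≡-Reasoning

  perm-injective : ∀ {j k} → perm ⟨$⟩ʳ j ≡ perm ⟨$⟩ʳ k → j ≡ k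
  perm-injective eq = trans (sym (inverseˡ perm)) (trans (cong (perm ⟨$⟩ˡ_) eq) (inverseˡ perm))

  position-arc⁻¹ : ∀ {j k x y} → perm ⟨$⟩ʳ j ≡ perm ⟨$⟩ʳ k →
    Linked (sign (signs j) x) (sign (signs k) y) → j ≡ k × Linked x y
  position-arc⁻¹ {j} eq linked with perm-injective eq
  ... | refl = refl , sign-linked⁻¹ (signs j) linked

  vertex-arc : ∀ u v → ΓArc C' u v ⇔ ΓArc C (vertex u) (vertex v)
  vertex-arc (inj₁ _) (inj₁ _) = mk⇔ (λ ()) (λ ())
  vertex-arc (inj₂ _) (inj₁ _) = mk⇔ (λ ()) (λ ())
  vertex-arc (inj₁ (c , _)) (inj₂ (j , _)) = mk⇔
    (λ eq → trans (lookup-act g c j) (cong (sign (signs j)) eq))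
    (λ eq → sign-injective (signs j) (trans (sym (lookup-act g c j)) eq))
  vertex-arc (inj₂ (j , _)) (inj₂ (k , _)) = mk⇔
    (λ { (refl , linked) → refl , sign-linked (signs j) linked })
    (λ { (eq , linked) → position-arc⁻¹ eq linked })

  Γ-image : Γ C' ≅ Γ C
  Γ-image = mk↔ₛ′ vertex vertex⁻¹ vertex-vertex⁻¹ vertex⁻¹-vertex , vertex-arc

open Γ-of-image using (Γ-image)

≅-sym : ∀ {G H} → G ≅ H → H ≅ G
≅-sym {G} {H} (f , arc) = mk↔ₛ′ from to strictlyInverseʳ strictlyInverseˡ , λ u v → mk⇔
  (λ a → Equivalence.from (arc (from u) (from v))
           (subst₂ (Arc H) (sym (strictlyInverseˡ u)) (sym (strictlyInverseˡ v)) a))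
  (λ a → subst₂ (Arc H) (strictlyInverseˡ u) (strictlyInverseˡ v) (Equivalence.to (arc (from u) (from v)) a))
  where open Inverse f

codeword-no-in-arc : ∀ {n} (C : LinearCode n) {c} v → ¬ ΓArc C v (inj₁ c)
codeword-no-in-arc C (inj₁ _) ()
codeword-no-in-arc C (inj₂ _) ()

position-in-arc : ∀ {n} (C : LinearCode n) p → ∃[ v ] ΓArc C v (inj₂ p)
position-in-arc C (j , 0# , ())
position-in-arc C (j , 1# , _) = inj₂ (j , two#)   , refl , inj₂ (refl , inj₁ refl)
position-in-arc C (j , 2# , _) = inj₂ (j , one#)   , refl , inj₁ (inj₁ refl , refl)
position-in-arc C (j , 3# , _) = inj₂ (j , two#)   , refl , inj₂ (refl , inj₂ refl)

≅-position : ∀ {n} {A B : LinearCode n} (h : Γ A ≅ Γ B) p → ∃[ q ] Inverse.to (proj₁ h) (inj₂ p) ≡ inj₂ q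
≅-position {A = A} {B} (f , arc) p with Inverse.to f (inj₂ p) in eq
... | inj₂ q = q , refl
... | inj₁ _ with position-in-arc A p
...   | v , v↦p = ⊥-elim (codeword-no-in-arc B (to v) (subst (ΓArc B (to v)) eq (Equivalence.to (arc v (inj₂ p)) v↦p)))
  where open Inverse f

-- Otherwise the inverse would send the position q to the codeword c.
≅-codeword : ∀ {n} {A B : LinearCode n} (h : Γ A ≅ Γ B) c → ∃[ d ] Inverse.to (proj₁ h) (inj₁ c) ≡ inj₁ d
≅-codeword h c with Inverse.to (proj₁ h) (inj₁ c) in eq
... | inj₁ d = d , refl
... | inj₂ q with ≅-position (≅-sym h) q
...   | _ , from-q≡p
  with trans (sym (Inverse.strictlyInverseʳ (proj₁ h) (inj₁ c))) (trans (cong (Inverse.from (proj₁ h)) eq) from-q≡p)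
...     | ()

odd-out-arc : ∀ {n} {u v : Position n} → odd (proj₁ (proj₂ u)) → PositionArc u v → v ≡ (proj₁ u , two#)
odd-out-arc _ (j≡k , inj₁ (_ , y≡2)) = Position-≡ (sym j≡k) y≡2
odd-out-arc o (_   , inj₂ (x≡2 , _)) = ⊥-elim (¬odd-2 (subst odd x≡2 o))

-- An injective arc-preserving self-map of the paths (j,1) ↔ (j,2) ↔ (j,3) is a signed permutation.
module PathRigidity {n} (f : Position n → Position n) (f-injective : ∀ {p q} → f p ≡ f q → p ≡ q)
  (f-arc : ∀ {p q} → PositionArc p q → PositionArc (f p) (f q)) where

  value : Position n → ℤ₄
  value p = proj₁ (proj₂ (f p))

  π : Fin n → Fin n
  π j = proj₁ (f (j , two#))

  -- (j,2) has the two distinct out-neighbours (j,1) and (j,3), an odd vertex has only one.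
  f-end-if-f-two-odd : ∀ j x → odd (value (j , two#)) → odd (proj₁ x) → f (j , x) ≡ (π j , two#)
  f-end-if-f-two-odd j x o ox =
    odd-out-arc {u = f (j , two#)} {f (j , x)} o (f-arc {j , two#} {j , x} (refl , inj₂ (refl , ox)))

  value-two-not-odd : ∀ j → ¬ odd (value (j , two#))
  value-two-not-odd j o
    with f-injective (trans (f-end-if-f-two-odd j one# o (inj₁ refl)) (sym (f-end-if-f-two-odd j three# o (inj₂ refl))))
  ... | ()

  f-two : ∀ j → f (j , two#) ≡ (π j , two#)
  f-two j = Position-≡ refl (ℤ₄#-¬odd⇒2 (proj₂ (f (j , two#))) (value-two-not-odd j))

  f-odd : ∀ j x → odd (proj₁ x) → proj₁ (f (j , x)) ≡ π j × odd (value (j , x))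
  f-odd j x o with f-arc {j , x} {j , two#} (refl , inj₁ (o , refl))
  ... | eq , inj₁ (o′ , _) = eq , o′
  ... | _  , inj₂ (_ , o′) = ⊥-elim (value-two-not-odd j o′)

  f-one : ∀ j → proj₁ (f (j , one#)) ≡ π j × odd (value (j , one#))
  f-one j = f-odd j one# (inj₁ refl)

  f-three : ∀ j → proj₁ (f (j , three#)) ≡ π j × odd (value (j , three#))
  f-three j = f-odd j three# (inj₂ refl)

  values-1-3-distinct : ∀ j → value (j , one#) ≢ value (j , three#)
  values-1-3-distinct j eq
    with f-injective {j , one#} {j , three#} (Position-≡ (trans (proj₁ (f-one j)) (sym (proj₁ (f-three j)))) eq)
  ... | ()

  signs-spec : ∀ j → ∃[ b ] value (j , one#) ≡ sign b 1# × value (j , three#) ≡ sign b 3#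
  signs-spec j = odd-pair-sign (proj₂ (f-one j)) (proj₂ (f-three j)) (values-1-3-distinct j)

  signs : Fin n → Bool
  signs j = proj₁ (signs-spec j)

  f-signed : ∀ j x → f (j , x) ≡ (π j , sign# (signs j) x)
  f-signed j (0# , ())
  f-signed j (1# , _) = Position-≡ (proj₁ (f-one j)) (proj₁ (proj₂ (signs-spec j)))
  f-signed j (2# , _) = trans (f-two j) (Position-≡ refl (sym (sign-2 (signs j))))
  f-signed j (3# , _) = Position-≡ (proj₁ (f-three j)) (proj₂ (proj₂ (signs-spec j)))

  proj₁-f : ∀ p → proj₁ (f p) ≡ π (proj₁ p)
  proj₁-f (j , x) = cong proj₁ (f-signed j x)

module Γ-rigidity {n} {A B : LinearCode n} (h : Γ A ≅ Γ B) where
  open Inverse (proj₁ h) public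

  position-map : Position n → Position n
  position-map p = proj₁ (≅-position h p)

  to-position : ∀ p → to (inj₂ p) ≡ inj₂ (position-map p)
  to-position p = proj₂ (≅-position h p)

  position-map-injective : ∀ {p q} → position-map p ≡ position-map q → p ≡ q
  position-map-injective {p} {q} eq = inj₂-injective (begin
    inj₂ p               ≡⟨ strictlyInverseʳ (inj₂ p) ⟨
    from (to (inj₂ p))   ≡⟨ cong from (trans (to-position p) (trans (cong inj₂ eq) (sym (to-position q)))) ⟩
    from (to (inj₂ q))   ≡⟨ strictlyInverseʳ (inj₂ q) ⟩
    inj₂ q               ∎)
    where open ≡-Reasoning

  position-map-arc : ∀ {p q} → PositionArc p q → PositionArc (position-map p) (position-map q)
  position-map-arc {p} {q} arc =
    subst₂ (ΓArc B) (to-position p) (to-position q) (Equivalence.to (proj₂ h (inj₂ p) (inj₂ q)) arc)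

  open PathRigidity position-map position-map-injective position-map-arc public using (π; signs; f-signed; proj₁-f)

module _ {n} {A B : LinearCode n} (h : Γ A ≅ Γ B) where
  private
    module H = Γ-rigidity h
    module H⁻¹ = Γ-rigidity (≅-sym h)

  position-map-inverseʳ : ∀ q → H.position-map (H⁻¹.position-map q) ≡ q
  position-map-inverseʳ q = inj₂-injective (begin
    inj₂ (H.position-map (H⁻¹.position-map q))  ≡⟨ H.to-position _ ⟨
    H.to (inj₂ (H⁻¹.position-map q))            ≡⟨ cong H.to (H⁻¹.to-position q) ⟨
    H.to (H.from (inj₂ q))                      ≡⟨ H.strictlyInverseˡ (inj₂ q) ⟩
    inj₂ q                                      ∎)
    where open ≡-Reasoning

  position-map-inverseˡ : ∀ p → H⁻¹.position-map (H.position-map p) ≡ p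
  position-map-inverseˡ p = inj₂-injective (begin
    inj₂ (H⁻¹.position-map (H.position-map p))  ≡⟨ H⁻¹.to-position _ ⟨
    H.from (inj₂ (H.position-map p))            ≡⟨ cong H.from (H.to-position p) ⟨
    H.from (H.to (inj₂ p))                      ≡⟨ H.strictlyInverseʳ (inj₂ p) ⟩
    inj₂ p                                      ∎)
    where open ≡-Reasoning

  induced : SignedPermutation n
  induced = record
    { perm  = permutation H.π H⁻¹.π
        (λ k → trans (sym (H.proj₁-f _)) (cong proj₁ (position-map-inverseʳ (k , two#))))
        (λ j → trans (sym (H⁻¹.proj₁-f _)) (cong proj₁ (position-map-inverseˡ (j , two#))))
    ; signs = H.signs
    }

  to-position-signed : ∀ j x → H.to (inj₂ (j , x)) ≡ inj₂ (H.π j , sign# (H.signs j) x)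
  to-position-signed j x = trans (H.to-position (j , x)) (cong inj₂ (H.f-signed j x))

  -- A codeword is determined by its out-neighbours (j, c_j), which move by the signed permutation.
  to-codeword-act : ∀ c d → H.to (inj₁ c) ≡ inj₁ d → act induced (proj₁ c) ≡ proj₁ d
  to-codeword-act c d to-c≡d = act-unique induced (proj₁ c) (proj₁ d) λ j → sign-determined (H.signs j) λ x →
    subst₂ (λ u v → ΓArc A (inj₁ c) (inj₂ (j , x)) ⇔ ΓArc B u v) to-c≡d (to-position-signed j x)
      (proj₂ h (inj₁ c) (inj₂ (j , x)))

  preimage-of-nonzero : ∀ (y : NonzeroCodeword B) → ∃[ c ] (c ∈C A × act induced c ≡ proj₁ y)
  preimage-of-nonzero y =
    let c , from-y≡c = ≅-codeword {A = B} {A} (≅-sym h) y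
    in proj₁ c , proj₁ (proj₂ c) , to-codeword-act c y (trans (cong H.to (sym from-y≡c)) (H.strictlyInverseˡ (inj₁ y)))

  act-nonzero-∈ : ∀ (c : NonzeroCodeword A) → act induced (proj₁ c) ∈C B
  act-nonzero-∈ c =
    let d , to-c≡d = ≅-codeword {A = A} {B} h c
    in subst (_∈C B) (sym (to-codeword-act c d to-c≡d)) (proj₁ (proj₂ d))

  Γ-iso⇒image : B ≡Image A under act induced
  Γ-iso⇒image = ≡Image-from-nonzero {C = B} {A} {act induced} (act-0w induced) preimage-of-nonzero act-nonzero-∈

equivalent⇒Γ-≅ : ∀ {n} {C C' : LinearCode n} → Equivalent C C' → Γ C ≅ Γ C'
equivalent⇒Γ-≅ {C = C} {C'} equivalent =
  let g , image = equivalent⇒signed {C = C} {C'} equivalent in ≅-sym (Γ-image {C = C} {C'} {g} image)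

Γ-≅⇒equivalent : ∀ {n} {C C' : LinearCode n} → Γ C ≅ Γ C' → Equivalent C C'
Γ-≅⇒equivalent {C = C} {C'} Γ-iso =
  let h = ≅-sym Γ-iso in signed⇒equivalent {C = C} {C'} (induced {A = C'} {C} h) (Γ-iso⇒image {A = C'} {C} h)

proposition5p13 : (n : ℕ) (C C' : LinearCode n) →
    Equivalent C C' ⇔ (Γ C ≅ Γ C')
proposition5p13 n C C' = mk⇔ equivalent⇒Γ-≅ Γ-≅⇒equivalent
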